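{- Let $M$ be a square subsection of a binary image and $b$ a positive integer, and let $\hat{P}_M$ denote the number of boundary pixels in $M$. If $M$ contains at least $b$ pixels of value $0$ and at least $b$ pixels of value $1$, then $\hat{P}_M\ge\sqrt{b}$.
   Context: A binary image assigns to each pixel (an integer pair) a value in $\{0,1\}$; a square subsection is the restriction to a $d\times d$ block of consecutive rows and columns. Two distinct pixels $(i,j),(i',j')$ are adjacent if $|i-i'|\le1$ and $|j-j'|\le1$; a pixel is a boundary pixel if it has an adjacent pixel with a different value. -}

module Defs where

open import Data.Nat using (ℕ)
open import Data.Integer using (ℤ; _+_; _-_; _≤_; _<_; ∣_∣; +_)
open import Data.Fin using (Fin)
open import Data.Product using (_×_; _,_; Σ)
open import Data.List using (List; length)
open import Data.List.Membership.Propositional using (_∈_)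
open import Data.List.Relation.Unary.Unique.Propositional using (Unique)
open import Relation.Binary.PropositionalEquality using (_≡_)
open import Relation.Nullary using (¬_)
open import Function.Bundles using (_⇔_)

Pixel : Set
Pixel = ℤ × ℤ

Image : Set
Image = Pixel → Fin 2

Adjacent : Pixel → Pixel → Set
Adjacent (i , j) (i' , j') =
  ¬ ((i , j) ≡ (i' , j')) × (∣ i - i' ∣ Data.Nat.≤ 1) × (∣ j - j' ∣ Data.Nat.≤ 1)
  where import Data.Nat

IsBoundary : Image → Pixel → Set
IsBoundary img p = Σ Pixel (λ q → Adjacent p q × ¬ (img p ≡ img q))

-- A square subsection: the d × d block of rows x0, …, x0+d-1 and columns y0, …, y0+d-1.
record Square : Set where
  constructor square
  field
    x0 : ℤ
    y0 : ℤ
    d  : ℕ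

InSquare : Square → Pixel → Set
InSquare (square x0 y0 d) (i , j) =
  (x0 ≤ i) × (i < x0 + + d) × (y0 ≤ j) × (j < y0 + + d)

-- L lists exactly (without repetition) the pixels satisfying P; its length is then
-- the number of such pixels.
Enumerates : List Pixel → (Pixel → Set) → Set
Enumerates L P = Unique L × (∀ p → (p ∈ L) ⇔ P p)

AtLeastPixelsOfValue : Image → Square → ℕ → Fin 2 → Set
AtLeastPixelsOfValue img M b v =
  Σ (List Pixel) (λ L → Unique L × (b Data.Nat.≤ length L) ×
     (∀ p → p ∈ L → InSquare M p × img p ≡ v))
  where import Data.Nat

BoundaryIn : Image → Square → Pixel → Set
BoundaryIn img M p = InSquare M p × IsBoundary img p

module Submission where

-- Let M be the D × D square with corner (x0 , y0) and L a list of its boundary pixels.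
-- Call a row or column of M varying if it contains pixels of both values.  By a discrete
-- intermediate value argument a varying row contains two horizontally adjacent pixels of
-- different values, hence a boundary pixel of M lying in that row; likewise for columns.
-- Index the pixels of M as (x0 + i , y0 + j) with i , j < D.  Then
--   (A) if every row varies, (i , j) is recovered from the boundary pixels found in rows
--       i and j (first coordinate of the first, shifted first coordinate of the second);
--   (B) if every column varies, symmetrically;
--   (C) otherwise some row t and some column s are constant, both of value c = img (t , s),
--       and a pixel (i , j) of the other value makes row i and column j varying, so it is
--       (first coordinate of a boundary pixel , second coordinate of a boundary pixel).
-- In every case a colour class with at least b pixels is covered by the image of L × L
-- under a map, and a duplicate-free list covered in this way has length at most |L|².

open import Defs
open import Data.Nat as ℕ using (ℕ; zero; suc; _≤_; _<_; _*_; z≤n; s≤s)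
open import Data.Nat.Properties
  using (≤-trans; ≤-reflexive; <⇒≤; ≤-<-trans; n<1+n; m<n⇒m<1+n; m<1+n⇒m<n∨m≡n; 0≢1+n)
open import Data.Integer as ℤ using (ℤ; +_; -_; ∣_∣; _+_; _-_)
import Data.Integer.Properties as ℤₚ
open import Data.Integer.Tactic.RingSolver using (solve-∀)
open import Data.Fin using (Fin; zero; suc)
import Data.Fin as Fin
open import Data.List using (List; []; _∷_; length; map; _++_; cartesianProductWith)
open import Data.List.Properties using (length-++; length-map; length-++-sucʳ)
open import Data.List.Membership.Propositional using (_∈_)
open import Data.List.Membership.Propositional.Properties
  using (∈-cartesianProductWith⁺; ∈-++⁺ˡ; ∈-++⁺ʳ; ∈-++⁻; ∈-∃++)
open import Data.List.Relation.Binary.Subset.Propositional using (_⊆_)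
open import Data.List.Relation.Unary.Any using (here; there)
import Data.List.Relation.Unary.All as All
open import Data.List.Relation.Unary.Unique.Propositional using (Unique)
open import Data.List.Relation.Unary.AllPairs using (_∷_)
open import Data.Product using (_×_; _,_; proj₁; proj₂; ∃; ∃₂)
open import Data.Sum using (_⊎_; inj₁; inj₂; [_,_]′)
import Data.Sum as Sum
open import Data.Empty using (⊥-elim)
open import Relation.Nullary.Decidable using (toSum)
open import Relation.Binary.Definitions using (DecidableEquality)
open import Relation.Binary.PropositionalEquality
  using (_≡_; _≢_; refl; sym; trans; cong; cong₂; subst; subst₂; module ≡-Reasoning)
open import Function.Bundles using (Equivalence)

module _ {A : Set} where

  unique-⊆-length : ∀ {xs ys : List A} → Unique xs → xs ⊆ ys → length xs ≤ length ys
  unique-⊆-length {[]} _ _ = z≤n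
  unique-⊆-length {x ∷ xs} {ys} (x∉xs ∷ uxs) xs⊆ys with ∈-∃++ (xs⊆ys (here refl))
  ... | us , ws , refl =
    ≤-trans (s≤s (unique-⊆-length uxs xs⊆us++ws)) (≤-reflexive (sym (length-++-sucʳ us x ws)))
    where
    xs⊆us++ws : xs ⊆ us ++ ws
    xs⊆us++ws y∈xs with ∈-++⁻ us (xs⊆ys (there y∈xs))
    ... | inj₁ y∈us = ∈-++⁺ˡ y∈us
    ... | inj₂ (here refl) = ⊥-elim (All.lookup x∉xs y∈xs refl)
    ... | inj₂ (there y∈ws) = ∈-++⁺ʳ us y∈ws

module _ {A B C : Set} (f : A → B → C) where

  length-cartesianProductWith : ∀ xs ys →
    length (cartesianProductWith f xs ys) ≡ length xs * length ys
  length-cartesianProductWith [] ys = refl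
  length-cartesianProductWith (x ∷ xs) ys = begin
    length (map (f x) ys ++ cartesianProductWith f xs ys)
      ≡⟨ length-++ (map (f x) ys) ⟩
    length (map (f x) ys) ℕ.+ length (cartesianProductWith f xs ys)
      ≡⟨ cong₂ ℕ._+_ (length-map (f x) ys) (length-cartesianProductWith xs ys) ⟩
    length ys ℕ.+ length xs * length ys ∎
    where open ≡-Reasoning

covered-length : {A B : Set} (g : A → A → B) (K : List B) (L : List A) → Unique K →
  (∀ {p} → p ∈ K → ∃₂ λ q q' → q ∈ L × q' ∈ L × g q q' ≡ p) →
  length K ≤ length L * length L
covered-length g K L uniqueK covered =
  ≤-trans (unique-⊆-length uniqueK K⊆L×L) (≤-reflexive (length-cartesianProductWith g L L))
  where
  K⊆L×L : K ⊆ cartesianProductWith g L L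
  K⊆L×L p∈K with covered p∈K
  ... | q , q' , q∈L , q'∈L , refl = ∈-cartesianProductWith⁺ g q∈L q'∈L

bounded-choice : {P Q : ℕ → Set} (n : ℕ) → (∀ k → k < n → P k ⊎ Q k) →
  (∀ k → k < n → P k) ⊎ (∃ λ k → k < n × Q k)
bounded-choice zero _ = inj₁ λ _ ()
bounded-choice (suc n) decide with bounded-choice n (λ k k<n → decide k (m<n⇒m<1+n k<n))
                                 | decide n (n<1+n n)
... | inj₂ (k , k<n , q) | _ = inj₂ (k , m<n⇒m<1+n k<n , q)
... | inj₁ _ | inj₂ q = inj₂ (n , n<1+n n , q)
... | inj₁ ps | inj₁ p = inj₁ λ k k<1+n → [ ps k , (λ { refl → p }) ]′ (m<1+n⇒m<n∨m≡n k<1+n)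

module _ {A : Set} where

  Constant : ℕ → (ℕ → A) → Set
  Constant n h = ∀ k → k < n → h k ≡ h 0

  Varies : ℕ → (ℕ → A) → Set
  Varies n h = ∃₂ λ j j' → j < n × j' < n × h j ≢ h j'

  Jumps : ℕ → (ℕ → A) → Set
  Jumps n h = ∃ λ k → suc k < n × h k ≢ h (suc k)

  steps-constant : (m : ℕ) (h : ℕ → A) → (∀ k → k < m → h k ≡ h (suc k)) →
    ∀ k → k ≤ m → h k ≡ h 0
  steps-constant m h steps zero _ = refl
  steps-constant m h steps (suc k) k<m =
    trans (sym (steps k k<m)) (steps-constant m h steps k (<⇒≤ k<m))

  module _ (_≟_ : DecidableEquality A) where

    constant-or-varies : (n : ℕ) (h : ℕ → A) → Constant n h ⊎ Varies n h
    constant-or-varies n h with bounded-choice n (λ k _ → toSum (h k ≟ h 0))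
    ... | inj₁ constant = inj₁ constant
    ... | inj₂ (k , k<n , hk≢h0) = inj₂ (k , 0 , k<n , ≤-<-trans z≤n k<n , hk≢h0)

    varies⇒jumps : (n : ℕ) (h : ℕ → A) → Varies n h → Jumps n h
    varies⇒jumps (suc m) h (j , j' , s≤s j≤m , s≤s j'≤m , hj≢hj')
      with bounded-choice m (λ k _ → toSum (h k ≟ h (suc k)))
    ... | inj₂ (k , k<m , jump) = k , s≤s k<m , jump
    ... | inj₁ steps = ⊥-elim (hj≢hj' (trans (constant j j≤m) (sym (constant j' j'≤m))))
      where constant = steps-constant m h steps

at : ℤ → ℤ → ℕ → ℕ → Pixel
at x0 y0 i j = (x0 + + i , y0 + + j)

module _ {D : ℕ} where

  offset-bounds : ∀ a {i} → i < D → a ℤ.≤ a + + i × a + + i ℤ.< a + + D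
  offset-bounds a {i} i<D = ℤₚ.i≤i+j a (+ i) , ℤₚ.+-monoʳ-< a (ℤ.+<+ i<D)

  as-offset : ∀ {a x} → a ℤ.≤ x → x ℤ.< a + + D → ∃ λ i → i < D × x ≡ a + + i
  as-offset {a} {x} a≤x x<a+D = ∣ x - a ∣ , i<D , x≡a+i
    where
    cancel : ∀ a x → (- a) + (a + x) ≡ x
    cancel = solve-∀
    shift : ∀ a x → a + (x - a) ≡ x
    shift = solve-∀
    x≡a+i : x ≡ a + + ∣ x - a ∣
    x≡a+i = trans (sym (shift a x)) (cong (λ z → a + z) (sym (ℤₚ.0≤i⇒+∣i∣≡i (ℤₚ.i≤j⇒0≤j-i a≤x))))
    i<D : ∣ x - a ∣ < D
    i<D = ℤₚ.drop‿+<+ (subst₂ ℤ._<_ (cancel a _) (cancel a _)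
            (ℤₚ.+-monoʳ-< (- a) (subst (ℤ._< a + + D) x≡a+i x<a+D)))

  at-in-square : ∀ x0 y0 {i j} → i < D → j < D → InSquare (square x0 y0 D) (at x0 y0 i j)
  at-in-square x0 y0 i<D j<D with offset-bounds x0 i<D | offset-bounds y0 j<D
  ... | x0≤x , x<x0+D | y0≤y , y<y0+D = x0≤x , x<x0+D , y0≤y , y<y0+D

  locate : ∀ {x0 y0 p} → InSquare (square x0 y0 D) p → ∃₂ λ i j → i < D × j < D × p ≡ at x0 y0 i j
  locate (x0≤x , x<x0+D , y0≤y , y<y0+D) with as-offset x0≤x x<x0+D | as-offset y0≤y y<y0+D
  ... | i , i<D , refl | j , j<D , refl = i , j , i<D , j<D , refl

unit-gap : ∀ a k → ∣ (a + + k) - (a + + suc k) ∣ ≡ 1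
unit-gap a k = cong ∣_∣ (step a (+ k))
  where
  step : ∀ a t → (a + t) - (a + (+ 1 + t)) ≡ - + 1
  step = solve-∀

self-gap : ∀ a → ∣ a - a ∣ ≡ 0
self-gap a = cong ∣_∣ (ℤₚ.+-inverseʳ a)

self-gap≤1 : ∀ a → ∣ a - a ∣ ≤ 1
self-gap≤1 a = subst (_≤ 1) (sym (self-gap a)) z≤n

same-row-adjacent : ∀ x {y y'} → ∣ y - y' ∣ ≡ 1 → Adjacent (x , y) (x , y')
same-row-adjacent x {y} {y'} gap = distinct , self-gap≤1 x , ≤-reflexive gap
  where
  distinct : (x , y) ≢ (x , y')
  distinct e = 0≢1+n (trans (sym (self-gap y)) (trans (cong (λ z → ∣ y - z ∣) (cong proj₂ e)) gap))

same-column-adjacent : ∀ {x x'} y → ∣ x - x' ∣ ≡ 1 → Adjacent (x , y) (x' , y)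
same-column-adjacent {x} {x'} y gap = distinct , ≤-reflexive gap , self-gap≤1 y
  where
  distinct : (x , y) ≢ (x' , y)
  distinct e = 0≢1+n (trans (sym (self-gap x)) (trans (cong (λ z → ∣ x - z ∣) (cong proj₁ e)) gap))

other-colour : {P : Fin 2 → Set} (c : Fin 2) → P zero → P (suc zero) → ∃ λ w → w ≢ c × P w
other-colour zero _ one = suc zero , (λ ()) , one
other-colour (suc zero) zero′ _ = zero , (λ ()) , zero′

module BoundaryOfSquare (img : Image) (x0 y0 : ℤ) (D : ℕ) (L : List Pixel)
  (enumerates : Enumerates L (BoundaryIn img (square x0 y0 D))) where

  M : Square
  M = square x0 y0 D

  pixel : ℕ → ℕ → Pixel
  pixel = at x0 y0

  row column : ℕ → ℕ → Fin 2
  row i k = img (pixel i k)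
  column j k = img (pixel k j)

  boundary-on-line : (line : ℕ → Pixel) → (∀ k → Adjacent (line k) (line (suc k))) →
    (∀ k → k < D → InSquare M (line k)) → Varies D (λ k → img (line k)) →
    ∃ λ k → line k ∈ L
  boundary-on-line line adjacent inM varies
    with varies⇒jumps Fin._≟_ D (λ k → img (line k)) varies
  ... | k , k+1<D , jump =
    k , Equivalence.from (proj₂ enumerates (line k)) (inM k (<⇒≤ k+1<D) , line (suc k) , adjacent k , jump)

  record Hit (coord : Pixel → ℤ) (origin : ℤ) (i : ℕ) : Set where
    constructor hit
    field
      boundary-pixel : Pixel
      listed : boundary-pixel ∈ L
      coordinate : coord boundary-pixel ≡ origin + + i

  row-hit : ∀ {i} → i < D → Varies D (row i) → Hit proj₁ x0 i
  row-hit {i} i<D varies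
    with boundary-on-line (pixel i) (λ k → same-row-adjacent _ (unit-gap y0 k))
                          (λ k k<D → at-in-square x0 y0 i<D k<D) varies
  ... | k , q∈L = hit (pixel i k) q∈L refl

  column-hit : ∀ {j} → j < D → Varies D (column j) → Hit proj₂ y0 j
  column-hit {j} j<D varies
    with boundary-on-line (λ k → pixel k j) (λ k → same-column-adjacent _ (unit-gap x0 k))
                          (λ k k<D → at-in-square x0 y0 k<D j<D) varies
  ... | k , q∈L = hit (pixel k j) q∈L refl

  class-bound : ∀ {b w} {coord coord' : Pixel → ℤ} {origin origin' : ℤ} →
    AtLeastPixelsOfValue img M b w →
    (∀ i j → i < D → j < D → img (pixel i j) ≡ w → Hit coord origin i × Hit coord' origin' j) →
    b ≤ length L * length L
  class-bound {coord = coord} {coord'} {origin} {origin'} (K , uniqueK , b≤K , inK) hits =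
    ≤-trans b≤K (covered-length g K L uniqueK covered)
    where
    g : Pixel → Pixel → Pixel
    g q q' = ((coord q - origin) + x0 , (coord' q' - origin') + y0)
    recentre : ∀ o a t → ((o + t) - o) + a ≡ a + t
    recentre = solve-∀
    covered : ∀ {p} → p ∈ K → ∃₂ λ q q' → q ∈ L × q' ∈ L × g q q' ≡ p
    covered {p} p∈K with inK p p∈K
    ... | p∈M , colour with locate p∈M
    ... | i , j , i<D , j<D , refl with hits i j i<D j<D colour
    ... | hit q q∈L e , hit q' q'∈L e' = q , q' , q∈L , q'∈L ,
      cong₂ _,_ (trans (cong (λ z → (z - origin) + x0) e) (recentre origin x0 (+ i)))
                (trans (cong (λ z → (z - origin') + y0) e') (recentre origin' y0 (+ j)))

  cross-hits : ∀ {t s i j} → t < D → s < D → Constant D (row t) → Constant D (column s) →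
    i < D → j < D → img (pixel i j) ≢ img (pixel t s) → Hit proj₁ x0 i × Hit proj₂ y0 j
  cross-hits {t} {s} {i} {j} t<D s<D row-t column-s i<D j<D differs =
    row-hit i<D (j , s , j<D , s<D , λ e → differs (trans e is≡ts)) ,
    column-hit j<D (i , t , i<D , t<D , λ e → differs (trans e tj≡ts))
    where
    is≡ts : img (pixel i s) ≡ img (pixel t s)
    is≡ts = trans (column-s i i<D) (sym (column-s t t<D))
    tj≡ts : img (pixel t j) ≡ img (pixel t s)
    tj≡ts = trans (row-t j j<D) (sym (row-t s s<D))

  rows-vary-or-some-constant :
    (∀ i → i < D → Varies D (row i)) ⊎ ∃ λ t → t < D × Constant D (row t)
  rows-vary-or-some-constant =
    bounded-choice D (λ i _ → Sum.swap (constant-or-varies Fin._≟_ D (row i)))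

  columns-vary-or-some-constant :
    (∀ j → j < D → Varies D (column j)) ⊎ ∃ λ s → s < D × Constant D (column s)
  columns-vary-or-some-constant =
    bounded-choice D (λ j _ → Sum.swap (constant-or-varies Fin._≟_ D (column j)))

mainTheorem4 : (img : Image) (M : Square) (b : ℕ) → 0 < b →
    AtLeastPixelsOfValue img M b zero → AtLeastPixelsOfValue img M b (suc zero) →
    ∀ L → Enumerates L (BoundaryIn img M) → b ≤ length L * length L
mainTheorem4 img (square x0 y0 D) b _ zeros ones L enumerates =
  [ all-rows-vary
  , (λ (t , t<D , row-t) →
       [ all-columns-vary
       , (λ (s , s<D , column-s) → constant-cross t<D s<D row-t column-s)
       ]′ columns-vary-or-some-constant)
  ]′ rows-vary-or-some-constant
  where
  open BoundaryOfSquare img x0 y0 D L enumerates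

  all-rows-vary : (∀ i → i < D → Varies D (row i)) → b ≤ length L * length L
  all-rows-vary rows =
    class-bound zeros λ i j i<D j<D _ → row-hit i<D (rows i i<D) , row-hit j<D (rows j j<D)

  all-columns-vary : (∀ j → j < D → Varies D (column j)) → b ≤ length L * length L
  all-columns-vary columns =
    class-bound zeros λ i j i<D j<D _ → column-hit i<D (columns i i<D) , column-hit j<D (columns j j<D)

  constant-cross : ∀ {t s} → t < D → s < D → Constant D (row t) → Constant D (column s) →
    b ≤ length L * length L
  constant-cross {t} {s} t<D s<D row-t column-s with other-colour (img (pixel t s)) zeros ones
  ... | w , w≢c , many = class-bound many λ i j i<D j<D colour →
    cross-hits t<D s<D row-t column-s i<D j<D (λ e → w≢c (trans (sym colour) e))
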